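{- Let $\mathsf{L}$ be an extension of $\mathsf{IUL}^-$ that admits a theorem of alternatives. Then (i) $\vdash_{\mathsf{L}} p \lor \neg p$, and (ii) $\vdash_{\mathsf{L}} 0 \to 1$, where $p$ is a propositional variable.
   Context: A logic over a propositional language $\mathcal{L}$ is a pair $\langle\mathcal{L},\vdash_{\mathsf{L}}\rangle$ where $\vdash_{\mathsf{L}}\subseteq\mathcal{P}(\mathrm{Fm}_{\mathcal{L}})\times\mathrm{Fm}_{\mathcal{L}}$ is a substitution-invariant consequence relation (reflexive, monotone, closed under cut and under substitutions) on the formulas $\mathrm{Fm}_{\mathcal{L}}$ over a fixed countably infinite set of variables; $\vdash_{\mathsf{L}}\varphi$ means $\emptyset\vdash_{\mathsf{L}}\varphi$. A logic $\mathsf{L}'$ is an extension of $\mathsf{L}$ if $\vdash_{\mathsf{L}}\subseteq\vdash_{\mathsf{L}'}$; for a set $X$ of formulas, $\mathsf{L}\oplus X$ is the smallest extension of $\mathsf{L}$ that includes $X$ (as theorems). The language $\mathcal{L}_m$ has binary connectives $\to,\cdot$ and constants $1,0$; set $\neg\varphi:=\varphi\to 0$, $\varphi+\psi:=\neg\varphi\to\psi$, $0\varphi:=0$, $(n+1)\varphi:=n\varphi+\varphi$, $\varphi^0:=1$, $\varphi^{n+1}:=\varphi^n\cdot\varphi$. Formulas of $\mathcal{L}_m$ are called multiplicative; their set is $\mathrm{Fm}_m$. The language $\mathcal{L}_\ell$ additionally has binary $\land,\lor$; its formulas form $\mathrm{Fm}_\ell$. $\mathsf{MALL}^-$ is the logic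 over $\mathcal{L}_\ell$ given by the axiom schemas $(\varphi\to\psi)\to((\psi\to\chi)\to(\varphi\to\chi))$, $(\varphi\to(\psi\to\chi))\to(\psi\to(\varphi\to\chi))$, $\varphi\to\varphi$, $\neg\neg\varphi\to\varphi$, $(\varphi\to(\psi\to\chi))\to((\varphi\cdot\psi)\to\chi)$, $\varphi\to(\psi\to(\varphi\cdot\psi))$, $\varphi\to(1\to\varphi)$, $1$, $(\varphi\land\psi)\to\varphi$, $(\varphi\land\psi)\to\psi$, $\varphi\to(\varphi\lor\psi)$, $\psi\to(\varphi\lor\psi)$, $((\varphi\to\psi)\land(\varphi\to\chi))\to(\varphi\to(\psi\land\chi))$, $((\varphi\to\chi)\land(\psi\to\chi))\to((\varphi\lor\psi)\to\chi)$, and rules modus ponens (from $\varphi$ and $\varphi\to\psi$ infer $\psi$) and adjunction (from $\varphi,\psi$ infer $\varphi\land\psi$). $\mathsf{IUL}^-:=\mathsf{MALL}^-\oplus\{((p\to q)\land 1)\lor((q\to p)\land 1)\}$. An extension $\mathsf{L}$ of $\mathsf{IUL}^-$ admits a theorem of alternatives if for all $\Sigma\cup\{\varphi_1,\dots,\varphi_n\}\subseteq\mathrm{Fm}_m$: $\Sigma\vdash_{\mathsf{L}}\varphi_1\lor\dots\lor\varphi_n$ iff $\Sigma\vdash_{\mathsf{L}}\lambda_1\varphi_1+\dots+\lambda_n\varphi_n$ for some $\lambda_1,\dots,\lambda_n\in\mathbb{N}$ not all $0$. -}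

module Defs where

open import Level using (Level; suc; zero)
open import Data.Nat using (ℕ) renaming (zero to nzero; suc to nsuc)
open import Data.Vec using (Vec; []; _∷_)
open import Data.Product using (Σ; _×_; _,_; ∃)
open import Data.Sum using (_⊎_)
open import Relation.Binary.PropositionalEquality using (_≡_)
open import Relation.Nullary using (¬_)
open import Data.Vec.Relation.Unary.Any using (Any)

infixr 4 _⇒_
infixl 6 _∧_ _∨_
infixl 7 _·_

data Fm : Set where
  var  : ℕ → Fm
  _⇒_  : Fm → Fm → Fm
  _·_  : Fm → Fm → Fm
  𝟙    : Fm
  𝟘    : Fm
  _∧_  : Fm → Fm → Fm
  _∨_  : Fm → Fm → Fm

data IsMult : Fm → Set where
  var : ∀ n → IsMult (var n)
  _⇒_ : ∀ {φ ψ} → IsMult φ → IsMult ψ → IsMult (φ ⇒ ψ)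
  _·_ : ∀ {φ ψ} → IsMult φ → IsMult ψ → IsMult (φ · ψ)
  𝟙   : IsMult 𝟙
  𝟘   : IsMult 𝟘

~_ : Fm → Fm
~ φ = φ ⇒ 𝟘

_⊕_ : Fm → Fm → Fm
φ ⊕ ψ = (~ φ) ⇒ ψ

_×ₙ_ : ℕ → Fm → Fm
nzero ×ₙ φ = 𝟘
nsuc n ×ₙ φ = (n ×ₙ φ) ⊕ φ

Subst : Set
Subst = ℕ → Fm

sub : Subst → Fm → Fm
sub σ (var n) = σ n
sub σ (φ ⇒ ψ) = sub σ φ ⇒ sub σ ψ
sub σ (φ · ψ) = sub σ φ · sub σ ψ
sub σ 𝟙 = 𝟙
sub σ 𝟘 = 𝟘
sub σ (φ ∧ ψ) = sub σ φ ∧ sub σ ψ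
sub σ (φ ∨ ψ) = sub σ φ ∨ sub σ ψ

FmSet : Set₁
FmSet = Fm → Set

_[_] : FmSet → Subst → FmSet
(Γ [ σ ]) ψ = Σ Fm (λ φ → Γ φ × (ψ ≡ sub σ φ))

∅ : FmSet
∅ _ = Data.Empty.⊥
  where import Data.Empty

record Logic : Set₁ where
  field
    _⊢_    : FmSet → Fm → Set
    refl⊢  : ∀ {Γ φ} → Γ φ → Γ ⊢ φ
    mono   : ∀ {Γ Δ φ} → (∀ ψ → Γ ψ → Δ ψ) → Γ ⊢ φ → Δ ⊢ φ
    cut    : ∀ {Γ Δ φ} → (∀ ψ → Δ ψ → Γ ⊢ ψ) → Δ ⊢ φ → Γ ⊢ φ
    substI : ∀ {Γ φ} (σ : Subst) → Γ ⊢ φ → (Γ [ σ ]) ⊢ sub σ φ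

open Logic public

Thm : Logic → Fm → Set
Thm L φ = _⊢_ L ∅ φ

-- Hilbert calculus for MALL⁻ extended by (all substitution instances of)
-- a set Ax of extra axioms.

data HDer (Ax : FmSet) (Γ : FmSet) : Fm → Set where
  prem  : ∀ {φ} → Γ φ → HDer Ax Γ φ
  extra : ∀ {φ} (σ : Subst) → Ax φ → HDer Ax Γ (sub σ φ)
  a1  : ∀ φ ψ χ → HDer Ax Γ ((φ ⇒ ψ) ⇒ ((ψ ⇒ χ) ⇒ (φ ⇒ χ)))
  a2  : ∀ φ ψ χ → HDer Ax Γ ((φ ⇒ (ψ ⇒ χ)) ⇒ (ψ ⇒ (φ ⇒ χ)))
  a3  : ∀ φ → HDer Ax Γ (φ ⇒ φ)
  a4  : ∀ φ → HDer Ax Γ (~ (~ φ) ⇒ φ)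
  a5  : ∀ φ ψ χ → HDer Ax Γ ((φ ⇒ (ψ ⇒ χ)) ⇒ ((φ · ψ) ⇒ χ))
  a6  : ∀ φ ψ → HDer Ax Γ (φ ⇒ (ψ ⇒ (φ · ψ)))
  a7  : ∀ φ → HDer Ax Γ (φ ⇒ (𝟙 ⇒ φ))
  a8  : HDer Ax Γ 𝟙
  a9  : ∀ φ ψ → HDer Ax Γ ((φ ∧ ψ) ⇒ φ)
  a10 : ∀ φ ψ → HDer Ax Γ ((φ ∧ ψ) ⇒ ψ)
  a11 : ∀ φ ψ → HDer Ax Γ (φ ⇒ (φ ∨ ψ))
  a12 : ∀ φ ψ → HDer Ax Γ (ψ ⇒ (φ ∨ ψ))
  a13 : ∀ φ ψ χ → HDer Ax Γ (((φ ⇒ ψ) ∧ (φ ⇒ χ)) ⇒ (φ ⇒ (ψ ∧ χ)))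
  a14 : ∀ φ ψ χ → HDer Ax Γ (((φ ⇒ χ) ∧ (ψ ⇒ χ)) ⇒ ((φ ∨ ψ) ⇒ χ))
  mp  : ∀ {φ ψ} → HDer Ax Γ φ → HDer Ax Γ (φ ⇒ ψ) → HDer Ax Γ ψ
  adj : ∀ {φ ψ} → HDer Ax Γ φ → HDer Ax Γ ψ → HDer Ax Γ (φ ∧ ψ)

prelin : Fm
prelin = ((var 0 ⇒ var 1) ∧ 𝟙) ∨ ((var 1 ⇒ var 0) ∧ 𝟙)

data PrelinAx : FmSet where
  ax : PrelinAx prelin

_⊢IUL_ : FmSet → Fm → Set
Γ ⊢IUL φ = HDer PrelinAx Γ φ

ExtendsIUL : Logic → Set₁
ExtendsIUL L = ∀ {Γ φ} → Γ ⊢IUL φ → _⊢_ L Γ φ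

⋁ : ∀ {n} → Vec Fm (nsuc n) → Fm
⋁ (φ ∷ []) = φ
⋁ (φ ∷ ψ ∷ φs) = φ ∨ ⋁ (ψ ∷ φs)

lincomb : ∀ {n} → Vec ℕ (nsuc n) → Vec Fm (nsuc n) → Fm
lincomb (l ∷ []) (φ ∷ []) = l ×ₙ φ
lincomb (l ∷ k ∷ ls) (φ ∷ ψ ∷ φs) = (l ×ₙ φ) ⊕ lincomb (k ∷ ls) (ψ ∷ φs)

AllMult : ∀ {n} → Vec Fm n → Set
AllMult [] = Data.Unit.⊤
  where import Data.Unit
AllMult (φ ∷ φs) = IsMult φ × AllMult φs

NotAllZero : ∀ {n} → Vec ℕ n → Set
NotAllZero ls = Any (λ l → ¬ (l ≡ 0)) ls

AdmitsTOA : Logic → Set₁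
AdmitsTOA L =
  ∀ (Σ' : FmSet) → (∀ ψ → Σ' ψ → IsMult ψ) →
  ∀ (n : ℕ) (φs : Vec Fm (nsuc n)) → AllMult φs →
  ((_⊢_ L Σ' (⋁ φs)) → ∃ (λ (ls : Vec ℕ (nsuc n)) → NotAllZero ls × _⊢_ L Σ' (lincomb ls φs)))
  × ((∃ (λ (ls : Vec ℕ (nsuc n)) → NotAllZero ls × _⊢_ L Σ' (lincomb ls φs))) → _⊢_ L Σ' (⋁ φs))

-- For (i), 1p + 1¬p, i.e. ¬(1p) → 1¬p, is already an
-- IUL⁻-theorem. For (ii), prelinearity with q := 1 gives ⊢ p ∨ (p → 1), hence
-- ⊢ l p + k (p → 1) with l, k not both 0. If k = 0 then ⊢ l p, so ⊢ p and the
-- logic is trivial; otherwise substituting 0 for p kills l·0 and leaves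
-- ⊢ k (0 → 1), whence ⊢ 0 → 1.
module Submission where

open import Defs
open import Data.Product using (_×_; _,_; proj₁; proj₂; ∃)
open import Data.Nat using (ℕ; zero; suc)
open import Data.Vec using (Vec; []; _∷_)
open import Data.Vec.Relation.Unary.Any using (here; there)
open import Data.Unit using (tt)
open import Relation.Binary.PropositionalEquality using (_≡_; _≢_; refl; cong; cong₂; subst)

⇒-precompose : ∀ {Γ φ ψ χ} → Γ ⊢IUL (φ ⇒ ψ) → Γ ⊢IUL ((ψ ⇒ χ) ⇒ (φ ⇒ χ))
⇒-precompose {φ = φ} {ψ} {χ} φ⇒ψ = mp φ⇒ψ (a1 φ ψ χ)

⇒-trans : ∀ {Γ φ ψ χ} → Γ ⊢IUL (φ ⇒ ψ) → Γ ⊢IUL (ψ ⇒ χ) → Γ ⊢IUL (φ ⇒ χ)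
⇒-trans φ⇒ψ ψ⇒χ = mp ψ⇒χ (⇒-precompose φ⇒ψ)

⇒-apply : ∀ {Γ φ ψ} → Γ ⊢IUL φ → Γ ⊢IUL ((φ ⇒ ψ) ⇒ ψ)
⇒-apply {φ = φ} {ψ} ⊢φ = mp ⊢φ (mp (a3 (φ ⇒ ψ)) (a2 (φ ⇒ ψ) φ ψ))

~𝟘⇒𝟙 : ∀ {Γ} → Γ ⊢IUL (~ 𝟘 ⇒ 𝟙)
~𝟘⇒𝟙 = ⇒-trans (⇒-precompose (⇒-apply a8)) (a4 𝟙)

-- 1 ×ₙ φ unfolds to ¬0 → φ.
⇒-1× : ∀ {Γ} φ → Γ ⊢IUL (φ ⇒ (1 ×ₙ φ))
⇒-1× φ = ⇒-trans (a7 φ) (⇒-precompose ~𝟘⇒𝟙)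

lincomb-excluded-middle : ∀ {Γ} φ → Γ ⊢IUL lincomb (1 ∷ 1 ∷ []) (φ ∷ ~ φ ∷ [])
lincomb-excluded-middle φ = ⇒-trans (⇒-precompose (⇒-1× φ)) (⇒-1× (~ φ))

∨-⇒𝟙 : ∀ {Γ} φ → Γ ⊢IUL (φ ∨ (φ ⇒ 𝟙))
∨-⇒𝟙 φ = mp (extra σ ax) (mp (adj left right) (a14 _ _ _))
  where
  σ : Subst
  σ zero    = 𝟙
  σ (suc _) = φ
  left : ∀ {Γ} → Γ ⊢IUL (((𝟙 ⇒ φ) ∧ 𝟙) ⇒ (φ ∨ (φ ⇒ 𝟙)))
  left = ⇒-trans (a9 _ _) (⇒-trans (⇒-apply a8) (a11 _ _))
  right : ∀ {Γ} → Γ ⊢IUL (((φ ⇒ 𝟙) ∧ 𝟙) ⇒ (φ ∨ (φ ⇒ 𝟙)))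
  right = ⇒-trans (a9 _ _) (a12 _ _)

×𝟘⇒𝟘 : ∀ {Γ} k → Γ ⊢IUL ((k ×ₙ 𝟘) ⇒ 𝟘)
×𝟘⇒𝟘 zero    = a3 𝟘
×𝟘⇒𝟘 (suc k) = ⇒-trans (a4 (k ×ₙ 𝟘)) (×𝟘⇒𝟘 k)

sub-×ₙ : ∀ σ k φ → sub σ (k ×ₙ φ) ≡ k ×ₙ sub σ φ
sub-×ₙ σ zero    φ = refl
sub-×ₙ σ (suc k) φ = cong (λ χ → ~ χ ⇒ sub σ φ) (sub-×ₙ σ k φ)

module _ (L : Logic) where

  Thm-sub : ∀ σ {φ} → Thm L φ → Thm L (sub σ φ)
  Thm-sub σ ⊢φ = mono L (λ { _ (_ , () , _) }) (substI L σ ⊢φ)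

  Thm-var⇒Thm : Thm L (var 0) → ∀ φ → Thm L φ
  Thm-var⇒Thm ⊢p φ = Thm-sub (λ _ → φ) ⊢p

  -- The IUL⁻-derivation may use φ as a premise, which cut then discharges.
  Thm-mp : ExtendsIUL L → ∀ {φ ψ} → Thm L φ →
           (∀ {Γ} → Γ φ → Γ ⊢IUL ψ) → Thm L ψ
  Thm-mp ext {φ} ⊢φ φ⊢ψ = cut L {Δ = _≡ φ} (λ { _ refl → ⊢φ }) (ext (φ⊢ψ refl))

module Alternatives (L : Logic) (toa : AdmitsTOA L) where

  private
    noPremise : ∀ ψ → ∅ ψ → IsMult ψ
    noPremise _ ()

  Thm-×ₙ⇒Thm : ∀ {φ} l → IsMult φ → l ≢ 0 → Thm L (l ×ₙ φ) → Thm L φ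
  Thm-×ₙ⇒Thm l mφ l≢0 ⊢lφ =
    proj₂ (toa ∅ noPremise 0 (_ ∷ []) (mφ , tt)) ((l ∷ []) , here l≢0 , ⊢lφ)

  Thm-lincomb⇒Thm-∨ : ∀ {φ ψ} l k → IsMult φ → IsMult ψ → NotAllZero (l ∷ k ∷ []) →
                      Thm L (lincomb (l ∷ k ∷ []) (φ ∷ ψ ∷ [])) → Thm L (φ ∨ ψ)
  Thm-lincomb⇒Thm-∨ l k mφ mψ nz ⊢lc =
    proj₂ (toa ∅ noPremise 1 (_ ∷ _ ∷ []) (mφ , mψ , tt)) ((l ∷ k ∷ []) , nz , ⊢lc)

  Thm-∨⇒Thm-lincomb : ∀ {φ ψ} → IsMult φ → IsMult ψ → Thm L (φ ∨ ψ) →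
                      ∃ λ (ls : Vec ℕ 2) → NotAllZero ls × Thm L (lincomb ls (φ ∷ ψ ∷ []))
  Thm-∨⇒Thm-lincomb mφ mψ = proj₁ (toa ∅ noPremise 1 (_ ∷ _ ∷ []) (mφ , mψ , tt))

NotAllZero-head : ∀ {l} → NotAllZero (l ∷ 0 ∷ []) → l ≢ 0
NotAllZero-head (here l≢0)          = l≢0
NotAllZero-head (there (here 0≢0)) = λ _ → 0≢0 refl

module _ (L : Logic) (ext : ExtendsIUL L) (toa : AdmitsTOA L) where

  open Alternatives L toa

  Thm-excluded-middle : Thm L (var 0 ∨ ~ var 0)
  Thm-excluded-middle =
    Thm-lincomb⇒Thm-∨ 1 1 (var 0) (var 0 ⇒ 𝟘) (here λ ())
      (ext (lincomb-excluded-middle (var 0)))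

  Thm-𝟘⇒𝟙 : Thm L (𝟘 ⇒ 𝟙)
  Thm-𝟘⇒𝟙 with Thm-∨⇒Thm-lincomb (var 0) (var 0 ⇒ 𝟙) (ext (∨-⇒𝟙 (var 0)))
  ... | (l ∷ zero ∷ []) , nz , ⊢lc = Thm-var⇒Thm L ⊢p (𝟘 ⇒ 𝟙)
    where
    ⊢lp : Thm L (l ×ₙ var 0)
    ⊢lp = Thm-mp L ext ⊢lc (λ lc → mp (prem lc) (a4 _))
    ⊢p : Thm L (var 0)
    ⊢p = Thm-×ₙ⇒Thm l (var 0) (NotAllZero-head nz) ⊢lp
  ... | (l ∷ suc k ∷ []) , _ , ⊢lc = Thm-×ₙ⇒Thm (suc k) (𝟘 ⇒ 𝟙) (λ ()) ⊢k[𝟘⇒𝟙]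
    where
    vars↦𝟘 : Subst
    vars↦𝟘 _ = 𝟘
    ⊢lc[𝟘] : Thm L (~ (l ×ₙ 𝟘) ⇒ (suc k ×ₙ (𝟘 ⇒ 𝟙)))
    ⊢lc[𝟘] = subst (Thm L)
      (cong₂ (λ χ θ → ~ χ ⇒ θ) (sub-×ₙ vars↦𝟘 l (var 0)) (sub-×ₙ vars↦𝟘 (suc k) (var 0 ⇒ 𝟙)))
      (Thm-sub L vars↦𝟘 ⊢lc)
    ⊢k[𝟘⇒𝟙] : Thm L (suc k ×ₙ (𝟘 ⇒ 𝟙))
    ⊢k[𝟘⇒𝟙] = Thm-mp L ext ⊢lc[𝟘] (λ lc → mp (×𝟘⇒𝟘 l) (prem lc))

lemma3p1 : (L : Logic) → ExtendsIUL L → AdmitsTOA L →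
    Thm L (var 0 ∨ ~ (var 0)) × Thm L (𝟘 ⇒ 𝟙)
lemma3p1 L ext toa = Thm-excluded-middle L ext toa , Thm-𝟘⇒𝟙 L ext toa
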